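{- Suppose $F$ is a system of $\mathbb{F}_2$-linear equations over variables $x_1,\dots,x_n$ that is an $(r,s)$-boundary expander for some $s>1$, and suppose $F'\subseteq F$ with $|F'|\le r$. Let $H\subseteq\mathbb{R}^n$ be a good halfspace. Then there exists $\rho\in\{0,1,*\}^n$ with $\mathrm{fix}(\rho)=\Gamma(F')$ such that every equation of $F'$ is satisfied by $\rho$, and $H\restriction\rho$ is good.
   Context: The constraint-variable graph $G_F$ is bipartite with a vertex per equation and per variable and an edge $(C,x)$ if $x$ occurs in $C$; $\Gamma(X)$ is the neighbourhood of $X$ in $G_F$ (so $\Gamma(F')$ is the set of variables occurring in $F'$). For $W$ a set of equations, $\delta(W)$ is the set of variables adjacent to exactly one equation of $W$, and $F$ is an $(r,s)$-boundary expander if $|\delta(W)|\ge s|W|$ for all sets $W$ of equations with $|W|\le r$. For $\rho\in\{0,1,*\}^n$, $\mathrm{free}(\rho)=\rho^{ -1}(*)$, $\mathrm{fix}(\rho)=[n]\setminus\mathrm{free}(\rho)$, and $H\restriction\rho:=\{x\in\mathbb{R}^{\mathrm{free}(\rho)}:\exists\alpha\in H,\ \alpha_{\mathrm{fix}(\rho)}=\rho_{\mathrm{fix}(\rho)},\ \alpha_{\mathrm{free}(\rho)}=x\}$. A halfspace in $\mathbb{R}^k$ is good if it contains the all-$\tfrac12$ vector. -}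

module Defs where

open import Level using (Level; suc; _⊔_)
open import Data.Bool using (Bool; true; false; _∧_; _xor_)
open import Data.Nat as ℕ using (ℕ)
open import Data.Fin as Fin using (Fin)
open import Data.Vec as Vec using ()
open import Data.Fin.Subset using (Subset; _∈_; ∣_∣)
open import Data.Vec using (Vec; tabulate; lookup)
open import Data.Product using (Σ; ∃; _×_; _,_)
open import Relation.Nullary using (¬_)
open import Relation.Binary.PropositionalEquality using (_≡_)
open import Relation.Binary.Structures using (IsTotalOrder)
open import Algebra.Structures using (IsCommutativeRing)

-- Ordered fields (stand-in for ℝ, which agda-stdlib lacks).
-- Inverse is total with the convention that only x ≉ 0 is constrained.

record OrderedField c ℓ₁ ℓ₂ : Set (suc (c ⊔ ℓ₁ ⊔ ℓ₂)) where
  infix  4 _≈_ _≤_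
  infixl 6 _+_
  infixl 7 _*_
  field
    Carrier : Set c
    _≈_     : Carrier → Carrier → Set ℓ₁
    _≤_     : Carrier → Carrier → Set ℓ₂
    _+_ _*_ : Carrier → Carrier → Carrier
    -_      : Carrier → Carrier
    _⁻¹     : Carrier → Carrier
    0# 1#   : Carrier
    isCommutativeRing : IsCommutativeRing _≈_ _+_ _*_ -_ 0# 1#
    isTotalOrder      : IsTotalOrder _≈_ _≤_
    0≉1               : ¬ (0# ≈ 1#)
    ⁻¹-inverse        : ∀ x → ¬ (x ≈ 0#) → x * (x ⁻¹) ≈ 1#
    +-mono-≤          : ∀ {x y} z → x ≤ y → x + z ≤ y + z
    *-nonneg          : ∀ {x y} → 0# ≤ x → 0# ≤ y → 0# ≤ x * y

  _<_ : Carrier → Carrier → Set (ℓ₁ ⊔ ℓ₂)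
  x < y = (x ≤ y) × ¬ (x ≈ y)

  half : Carrier
  half = (1# + 1#) ⁻¹

  fromℕ : ℕ → Carrier
  fromℕ ℕ.zero    = 0#
  fromℕ (ℕ.suc k) = 1# + fromℕ k

  sumFin : ∀ {n} → (Fin n → Carrier) → Carrier
  sumFin {ℕ.zero}  f = 0#
  sumFin {ℕ.suc n} f = f Fin.zero + sumFin (λ i → f (Fin.suc i))

-- F₂-linear systems.  An equation over x₁..xₙ is  ⊕_{i ∈ vars} xᵢ = rhs.

record Equation (n : ℕ) : Set where
  constructor eqn
  field
    vars : Subset n
    rhs  : Bool
open Equation public

System : ℕ → ℕ → Set
System m n = Fin m → Equation n

Γ : ∀ {m n} → System m n → Subset m → Subset n
Γ {m} F F' = tabulate λ x → anyFin λ j → lookup F' j ∧ lookup (vars (F j)) x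
  where
  anyFin : ∀ {k} → (Fin k → Bool) → Bool
  anyFin {ℕ.zero}  f = false
  anyFin {ℕ.suc k} f with f Fin.zero
  ... | true  = true
  ... | false = anyFin (λ i → f (Fin.suc i))

degIn : ∀ {m n} → System m n → Subset m → Fin n → ℕ
degIn F W x = ∣ tabulate (λ j → lookup W j ∧ lookup (vars (F j)) x) ∣

δ : ∀ {m n} → System m n → Subset m → Subset n
δ F W = tabulate λ x → isOne (degIn F W x)
  where
  isOne : ℕ → Bool
  isOne (ℕ.suc ℕ.zero) = true
  isOne _              = false

IsBoundaryExpander : ∀ {c ℓ₁ ℓ₂} (K : OrderedField c ℓ₁ ℓ₂) {m n} →
                     System m n → ℕ → OrderedField.Carrier K → Set (ℓ₂)
IsBoundaryExpander K {m} F r s =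
  ∀ (W : Subset m) → ∣ W ∣ ℕ.≤ r →
    fromℕ (∣ δ F W ∣) ≥' (s * fromℕ (∣ W ∣))
  where
  open OrderedField K
  _≥'_ : Carrier → Carrier → Set _
  x ≥' y = y ≤ x

data Val : Set where
  v0 v1 ⋆ : Val

Restriction : ℕ → Set
Restriction n = Fin n → Val

isFixed : Val → Bool
isFixed ⋆ = false
isFixed _ = true

fix : ∀ {n} → Restriction n → Subset n
fix ρ = tabulate λ i → isFixed (ρ i)

valBool : Val → Bool
valBool v1 = true
valBool _  = false

parity : ∀ {n} → Subset n → (Fin n → Bool) → Bool
parity {ℕ.zero}  S a = false
parity {ℕ.suc n} S a =
  (lookup S Fin.zero ∧ a Fin.zero) xor parity (Vec.tail S) (λ i → a (Fin.suc i))

SatisfiedBy : ∀ {n} → Equation n → Restriction n → Set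
SatisfiedBy C ρ =
  (∀ i → i ∈ vars C → isFixed (ρ i) ≡ true) ×
  parity (vars C) (λ i → valBool (ρ i)) ≡ rhs C

record Halfspace {c ℓ₁ ℓ₂} (K : OrderedField c ℓ₁ ℓ₂) (n : ℕ) : Set c where
  constructor halfspace
  field
    coeff : Fin n → OrderedField.Carrier K
    bound : OrderedField.Carrier K

_∈H_ : ∀ {c ℓ₁ ℓ₂} {K : OrderedField c ℓ₁ ℓ₂} {n} →
       (Fin n → OrderedField.Carrier K) → Halfspace K n → Set ℓ₂
_∈H_ {K = K} x H = bound ≤ sumFin (λ i → coeff i * x i)
  where open OrderedField K
        open Halfspace H

valK : ∀ {c ℓ₁ ℓ₂} (K : OrderedField c ℓ₁ ℓ₂) → Val → OrderedField.Carrier K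
valK K v0 = OrderedField.0# K
valK K v1 = OrderedField.1# K
valK K ⋆  = OrderedField.0# K   -- unused: only read at fixed coordinates

FreePoint : ∀ {c ℓ₁ ℓ₂} (K : OrderedField c ℓ₁ ℓ₂) {n} → Restriction n → Set c
FreePoint K ρ = (i : Fin _) → ρ i ≡ ⋆ → OrderedField.Carrier K

-- ρ ∈ x ↾ H  means: the point x ∈ K^{free(ρ)} lies in H ↾ ρ
_∈_↾_ : ∀ {c ℓ₁ ℓ₂} {K : OrderedField c ℓ₁ ℓ₂} {n} →
        (ρ : Restriction n) → FreePoint K ρ → Halfspace K n → Set _
_∈_↾_ {K = K} {n} ρ x H = Σ (Fin n → Carrier) λ α →
    (α ∈H H)
  × (∀ i → isFixed (ρ i) ≡ true → α i ≈ valK K (ρ i))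
  × (∀ i (p : ρ i ≡ ⋆) → α i ≈ x i p)
  where open OrderedField K

IsGood : ∀ {c ℓ₁ ℓ₂} {K : OrderedField c ℓ₁ ℓ₂} {n} → Halfspace K n → Set ℓ₂
IsGood {K = K} H = (λ _ → OrderedField.half K) ∈H H

IsGood↾ : ∀ {c ℓ₁ ℓ₂} {K : OrderedField c ℓ₁ ℓ₂} {n} → Halfspace K n → Restriction n → Set _
IsGood↾ {K = K} {n} H ρ = _∈_↾_ {K = K} ρ (λ _ _ → OrderedField.half K) H

{-# OPTIONS --safe #-}
module Submission where

-- Let a be the normal vector of H. By induction on |W| we find, for every W ⊆ F with
-- |W| ≤ r, a 0/1 assignment σ satisfying W whose excess Σ_{i ∈ Γ(W)} aᵢ (σᵢ − ½) is
-- nonnegative; fixing Γ(F') according to σ and every other coordinate to ½ then gives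
-- a point of H, so H ↾ ρ is good.  Since s > 1, a nonempty W has |δ(W)| > |W|, so by
-- double counting some equation C ∈ W has two variables y ≠ z occurring in no other
-- equation of W.  Extend the assignment for W ∖ {C}: give the variables new to C their
-- favourable value, repair the parity of C at y (σ₁), and flip y and z (σ₂).  Both
-- satisfy C, and on the new variables the two excesses sum to at least 0 because the
-- contributions at y and z cancel; hence one of σ₁, σ₂ will do.

open import Defs

open import Algebra.Bundles using (CommutativeRing)
import Algebra.Properties.CommutativeMonoid.Sum as CommutativeMonoidSum
import Algebra.Properties.Ring as RingProperties
open import Data.Bool using (Bool; true; false; not; _∧_; _∨_; _xor_; if_then_else_)
import Data.Bool.Properties as Boolₚ
open import Data.Empty using (⊥-elim)
open import Data.Fin using (Fin; zero; suc; _≟_)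
import Data.Fin.Properties as Finₚ
open import Data.Fin.Subset using (Subset; _∈_; _∉_; ∣_∣; _-_; Nonempty; Empty)
import Data.Fin.Subset.Properties as Subsetₚ
open import Data.Nat as ℕ using (ℕ)
import Data.Nat.Properties as ℕₚ
import Data.Nat.Induction as ℕᵢ
open import Data.Product using (Σ; ∃; ∃₂; _×_; _,_; proj₁; proj₂)
open import Data.Sum using (_⊎_; inj₁; inj₂; [_,_]′)
open import Data.Vec using ([]; _∷_; lookup; tabulate; here; there)
open import Data.Vec.Functional using (updateAt)
open import Data.Vec.Functional.Properties using (updateAt-updates; updateAt-minimal)
import Data.Vec.Properties as Vecₚ
open import Function using (_∘_)
open import Induction.WellFounded using (Acc; acc)
open import Relation.Nullary using (¬_; yes; no; contradiction)
open import Relation.Binary.PropositionalEquality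
open import Relation.Binary.Bundles using (Poset)
open import Relation.Binary.Structures using (IsTotalOrder)
import Relation.Binary.Reasoning.PartialOrder as PosetReasoning

∧≡true⁻ : ∀ {a b} → a ∧ b ≡ true → a ≡ true × b ≡ true
∧≡true⁻ {true} {true} _ = refl , refl

x∉p-x : ∀ {k} {x : Fin k} (p : Subset k) → x ∉ p - x
x∉p-x {x = zero}  (_ ∷ p) ()
x∉p-x {x = suc x} (_ ∷ p) (there x∈p-x) = x∉p-x p x∈p-x

module Counting where

  open import Data.Nat using (_+_; _≤_; _<_; z≤n; s≤s)

  module ℕΣ = CommutativeMonoidSum ℕₚ.+-0-commutativeMonoid

  bit : Bool → ℕ
  bit true  = 1
  bit false = 0

  count : ∀ {k} → (Fin k → Bool) → ℕ
  count g = ℕΣ.sum (λ i → bit (g i))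

  ∣p∣≡count : ∀ {k} (p : Subset k) → ∣ p ∣ ≡ count (lookup p)
  ∣p∣≡count []          = refl
  ∣p∣≡count (true  ∷ p) = cong ℕ.suc (∣p∣≡count p)
  ∣p∣≡count (false ∷ p) = ∣p∣≡count p

  count-cong : ∀ {k} {g h : Fin k → Bool} → (∀ i → g i ≡ h i) → count g ≡ count h
  count-cong g≗h = ℕΣ.sum-cong-≗ (cong bit ∘ g≗h)

  ∣tabulate∣≡count : ∀ {k} (g : Fin k → Bool) → ∣ tabulate g ∣ ≡ count g
  ∣tabulate∣≡count g = trans (∣p∣≡count (tabulate g)) (count-cong (Vecₚ.lookup∘tabulate g))

  0<count : ∀ {k} (g : Fin k → Bool) {i} → g i ≡ true → 0 < count g
  0<count g {zero}  gi = subst (λ b → 0 < bit b + count (g ∘ suc)) (sym gi) (s≤s z≤n)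
  0<count g {suc i} gi = ℕₚ.<-≤-trans (0<count (g ∘ suc) gi) (ℕₚ.m≤n+m _ (bit (g zero)))

  count≤1⇒unique : ∀ {k} (g : Fin k → Bool) → count g ≤ 1 →
                   ∀ {i i'} → g i ≡ true → g i' ≡ true → i ≡ i'
  count≤1⇒unique g c≤1 {zero}  {zero}   _  _   = refl
  count≤1⇒unique g c≤1 {zero}  {suc i'} gi gi' rewrite gi =
    ⊥-elim (ℕₚ.<⇒≱ (0<count (g ∘ suc) gi') (ℕₚ.≤-pred c≤1))
  count≤1⇒unique g c≤1 {suc i} {zero}   gi gi' rewrite gi' =
    ⊥-elim (ℕₚ.<⇒≱ (0<count (g ∘ suc) gi) (ℕₚ.≤-pred c≤1))
  count≤1⇒unique g c≤1 {suc i} {suc i'} gi gi' =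
    cong suc (count≤1⇒unique (g ∘ suc) (ℕₚ.≤-trans (ℕₚ.m≤n+m _ (bit (g zero))) c≤1) gi gi')

  0<count⇒∃ : ∀ {k} (g : Fin k → Bool) → 0 < count g → ∃ λ i → g i ≡ true
  0<count⇒∃ {ℕ.suc k} g c>0 with g zero in g₀
  ... | true  = zero , g₀
  ... | false = let i , gi = 0<count⇒∃ (g ∘ suc) c>0 in suc i , gi

  count≥2⇒∃₂ : ∀ {k} (g : Fin k → Bool) → 2 ≤ count g →
               ∃₂ λ y z → y ≢ z × g y ≡ true × g z ≡ true
  count≥2⇒∃₂ {ℕ.suc k} g c≥2 with g zero in g₀
  ... | true  = let z , gz = 0<count⇒∃ (g ∘ suc) (ℕₚ.≤-pred c≥2) in zero , suc z , (λ ()) , g₀ , gz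
  ... | false = let y , z , y≢z , gy , gz = count≥2⇒∃₂ (g ∘ suc) c≥2
                in suc y , suc z , y≢z ∘ Finₚ.suc-injective , gy , gz

  ∑-mono-≤ : ∀ {k} {f g : Fin k → ℕ} → (∀ i → f i ≤ g i) → ℕΣ.sum f ≤ ℕΣ.sum g
  ∑-mono-≤ {ℕ.zero}  f≤g = z≤n
  ∑-mono-≤ {ℕ.suc k} f≤g = ℕₚ.+-mono-≤ (f≤g zero) (∑-mono-≤ (f≤g ∘ suc))

  count-by-rows : ∀ {m n} (A : Fin m → Fin n → Bool) (d : Fin n → Bool) →
                  (∀ x → d x ≡ true → count (λ j → A j x) ≡ 1) →
                  count d ≡ ℕΣ.sum (λ j → count (λ x → A j x ∧ d x))
  count-by-rows {m} A d column = begin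
    count d                                        ≡⟨ ℕΣ.sum-cong-≗ column-count ⟩
    ℕΣ.sum (λ x → count (λ j → A j x ∧ d x))       ≡⟨ ℕΣ.∑-comm (λ x j → bit (A j x ∧ d x)) ⟩
    ℕΣ.sum (λ j → count (λ x → A j x ∧ d x))       ∎
    where
    open ≡-Reasoning
    column-count : ∀ x → bit (d x) ≡ count (λ j → A j x ∧ d x)
    column-count x with d x in dx
    ... | true  = sym (trans (count-cong (λ j → Boolₚ.∧-identityʳ (A j x))) (column x dx))
    ... | false = sym (trans (count-cong (λ j → Boolₚ.∧-zeroʳ (A j x))) (ℕΣ.sum-replicate-zero m))

open Counting

module Incidence where

  open import Data.Nat using (_≤_; _<_)

  -- Γ is defined through a private helper; on a one-variable system, lookup at zero
  -- unfolds to that helper, which is what lets us compute Γ one equation at a time.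
  restrictTo : ∀ {m n} → System m n → Fin n → System m 1
  restrictTo F x j = eqn (lookup (vars (F j)) x ∷ []) (rhs (F j))

  lookup-Γ-restrictTo : ∀ {m n} (F : System m n) W x → lookup (Γ F W) x ≡ lookup (Γ (restrictTo F x) W) zero
  lookup-Γ-restrictTo F W x = Vecₚ.lookup∘tabulate _ x

  lookup-Γ₁-∷ : ∀ {m} (F : System (ℕ.suc m) 1) w W →
                lookup (Γ F (w ∷ W)) zero ≡ (w ∧ lookup (vars (F zero)) zero) ∨ lookup (Γ (F ∘ suc) W) zero
  lookup-Γ₁-∷ F w W with w ∧ lookup (vars (F zero)) zero
  ... | true  = refl
  ... | false = refl

  lookup-Γ-∷ : ∀ {m n} (F : System (ℕ.suc m) n) w W x →
               lookup (Γ F (w ∷ W)) x ≡ (w ∧ lookup (vars (F zero)) x) ∨ lookup (Γ (F ∘ suc) W) x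
  lookup-Γ-∷ F w W x = trans (lookup-Γ-restrictTo F (w ∷ W) x)
    (trans (lookup-Γ₁-∷ (restrictTo F x) w W) (cong (_ ∨_) (sym (lookup-Γ-restrictTo (F ∘ suc) W x))))

  ∈Γ⁺ : ∀ {m n} (F : System m n) {W j x} → j ∈ W → x ∈ vars (F j) → x ∈ Γ F W
  ∈Γ⁺ F {true ∷ W} {x = x} here x∈Fj = Vecₚ.lookup⇒[]= x _
    (trans (lookup-Γ-∷ F true W x) (cong (_∨ lookup (Γ (F ∘ suc) W) x) (Vecₚ.[]=⇒lookup x∈Fj)))
  ∈Γ⁺ F {w ∷ W} {x = x} (there j∈W) x∈Fj = Vecₚ.lookup⇒[]= x _
    (trans (lookup-Γ-∷ F w W x)
      (trans (cong (_ ∨_) (Vecₚ.[]=⇒lookup (∈Γ⁺ (F ∘ suc) j∈W x∈Fj))) (Boolₚ.∨-zeroʳ _)))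

  ∈Γ⁻ : ∀ {m n} (F : System m n) {W x} → x ∈ Γ F W → ∃ λ j → j ∈ W × x ∈ vars (F j)
  ∈Γ⁻ F {W} {x} x∈Γ = witness F W (Vecₚ.[]=⇒lookup x∈Γ)
    where
    shift : ∀ {m} {F : System (ℕ.suc m) _} {w W} →
            (∃ λ j → j ∈ W × x ∈ vars (F (suc j))) → ∃ λ j → j ∈ (w ∷ W) × x ∈ vars (F j)
    shift (j , j∈W , x∈Fj) = suc j , there j∈W , x∈Fj

    witness : ∀ {m} (F : System m _) W → lookup (Γ F W) x ≡ true → ∃ λ j → j ∈ W × x ∈ vars (F j)
    witness F [] Γx with () ← trans (sym (lookup-Γ-restrictTo F [] x)) Γx
    witness F (true ∷ W) Γx
      with lookup (vars (F zero)) x in x∈F₀ | trans (sym (lookup-Γ-∷ F true W x)) Γx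
    ... | true  | _   = zero , here , Vecₚ.lookup⇒[]= x _ x∈F₀
    ... | false | Γ'x = shift {F = F} (witness (F ∘ suc) W Γ'x)
    witness F (false ∷ W) Γx = shift {F = F} (witness (F ∘ suc) W (trans (sym (lookup-Γ-∷ F false W x)) Γx))

  ∈δ⇒degIn≡1 : ∀ {m n} (F : System m n) {W x} → x ∈ δ F W → degIn F W x ≡ 1
  ∈δ⇒degIn≡1 F {W} {x} x∈δ
    with degIn F W x | trans (sym (Vecₚ.lookup∘tabulate _ x)) (Vecₚ.[]=⇒lookup x∈δ)
  ... | 1 | _ = refl

  UniqueNeighbour : ∀ {m n} → System m n → Subset m → Fin m → Fin n → Set
  UniqueNeighbour F W j x = x ∈ vars (F j) × (∀ {j'} → j' ∈ W → x ∈ vars (F j') → j' ≡ j)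

  module _ {m n} (F : System m n) (W : Subset m) where

    private
      incident : Fin m → Fin n → Bool
      incident j x = lookup W j ∧ lookup (vars (F j)) x

      boundary : Fin n → Bool
      boundary = lookup (δ F W)

      privateCount : Fin m → ℕ
      privateCount j = count (λ x → incident j x ∧ boundary x)

      boundary-degree : ∀ x → boundary x ≡ true → count (λ j → incident j x) ≡ 1
      boundary-degree x δx = trans (sym (∣tabulate∣≡count (λ j → incident j x))) (∈δ⇒degIn≡1 F {W} (Vecₚ.lookup⇒[]= x (δ F W) δx))

    ∣W∣<∣δW∣⇒uniqueNeighbours : ∣ W ∣ < ∣ δ F W ∣ →
      ∃ λ j → j ∈ W × ∃₂ λ y z → y ≢ z × UniqueNeighbour F W j y × UniqueNeighbour F W j z
    ∣W∣<∣δW∣⇒uniqueNeighbours ∣W∣<∣δW∣ with Finₚ.any? (λ j → 2 ℕ.≤? privateCount j)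
    ... | yes (j , 2≤priv) =
      let y , z , y≢z , y∈ , z∈ = count≥2⇒∃₂ (λ x → incident j x ∧ boundary x) 2≤priv
      in j , Vecₚ.lookup⇒[]= j W (proj₁ (∧≡true⁻ (proj₁ (∧≡true⁻ y∈))))
           , y , z , y≢z , unique y∈ , unique z∈
      where
      unique : ∀ {x} → incident j x ∧ boundary x ≡ true → UniqueNeighbour F W j x
      unique {x} e with ∧≡true⁻ e
      ... | jx , δx = Vecₚ.lookup⇒[]= x (vars (F j)) (proj₂ (∧≡true⁻ jx))
                    , λ {j'} j'∈W x∈Fj' → count≤1⇒unique (λ j → incident j x)
                        (ℕₚ.≤-reflexive (boundary-degree x δx))
                        (cong₂ _∧_ (Vecₚ.[]=⇒lookup j'∈W) (Vecₚ.[]=⇒lookup x∈Fj')) jx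
    ... | no ¬2≤priv = ⊥-elim (ℕₚ.<⇒≱ ∣W∣<∣δW∣ ∣δW∣≤∣W∣)
      where
      open ℕₚ.≤-Reasoning
      privateCount≤ : ∀ j → privateCount j ≤ bit (lookup W j)
      privateCount≤ j with lookup W j | ¬2≤priv ∘ (j ,_)
      ... | true  | ¬2≤privⱼ = ℕₚ.≤-pred (ℕₚ.≰⇒> ¬2≤privⱼ)
      ... | false | _        = ℕₚ.≤-reflexive (ℕΣ.sum-replicate-zero n)
      ∣δW∣≤∣W∣ : ∣ δ F W ∣ ≤ ∣ W ∣
      ∣δW∣≤∣W∣ = begin
        ∣ δ F W ∣                      ≡⟨ ∣p∣≡count (δ F W) ⟩
        count boundary                 ≡⟨ count-by-rows incident boundary boundary-degree ⟩
        ℕΣ.sum privateCount            ≤⟨ ∑-mono-≤ privateCount≤ ⟩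
        count (lookup W)               ≡⟨ ∣p∣≡count W ⟨
        ∣ W ∣                          ∎

  Empty⇒∉Γ : ∀ {m n} (F : System m n) {W x} → Empty W → x ∉ Γ F W
  Empty⇒∉Γ F empty x∈Γ = let j , j∈W , _ = ∈Γ⁻ F x∈Γ in empty (j , j∈W)

  uniqueNeighbour⇒∉Γ-remove : ∀ {m n} (F : System m n) {W j x} → UniqueNeighbour F W j x → x ∉ Γ F (W - j)
  uniqueNeighbour⇒∉Γ-remove F {W} {j} (_ , unique) x∈Γ
    with j' , j'∈W-j , x∈Fj' ← ∈Γ⁻ F x∈Γ
    with refl ← unique (Subsetₚ.p─q⊆p W _ j'∈W-j) x∈Fj'
    = x∉p-x W j'∈W-j

  lookup-Γ-remove : ∀ {m n} (F : System m n) {W j} → j ∈ W →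
                    ∀ x → lookup (Γ F W) x ≡ lookup (Γ F (W - j)) x ∨ lookup (vars (F j)) x
  lookup-Γ-remove F {W} {j} j∈W x
    with lookup (Γ F (W - j)) x in x∈Γ' | lookup (vars (F j)) x in x∈Fj
  ... | true  | _    = let j' , j'∈W-j , x∈Fj' = ∈Γ⁻ F {W - j} (Vecₚ.lookup⇒[]= x _ x∈Γ')
                       in Vecₚ.[]=⇒lookup (∈Γ⁺ F (Subsetₚ.p─q⊆p W _ j'∈W-j) x∈Fj')
  ... | false | true = Vecₚ.[]=⇒lookup (∈Γ⁺ F j∈W (Vecₚ.lookup⇒[]= x _ x∈Fj))
  ... | false | false with lookup (Γ F W) x in x∈Γ
  ...   | false = refl
  ...   | true with j' , j'∈W , x∈Fj' ← ∈Γ⁻ F {W} (Vecₚ.lookup⇒[]= x _ x∈Γ) | j' ≟ j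
  ...     | yes refl = contradiction (trans (sym (Vecₚ.[]=⇒lookup x∈Fj')) x∈Fj) λ ()
  ...     | no j'≢j  = contradiction
                         (trans (sym (Vecₚ.[]=⇒lookup (∈Γ⁺ F {W - j} (Subsetₚ.x∈p∧x≢y⇒x∈p-y j'∈W j'≢j) x∈Fj'))) x∈Γ') λ ()

open Incidence

module OrderedFieldProperties {c ℓ₁ ℓ₂} (K : OrderedField c ℓ₁ ℓ₂) where

  open OrderedField K

  commutativeRing : CommutativeRing c ℓ₁
  commutativeRing = record { isCommutativeRing = isCommutativeRing }

  module R = CommutativeRing commutativeRing
  module Rₚ = RingProperties R.ring
  module ≤ = IsTotalOrder isTotalOrder

  ≤-poset : Poset c ℓ₁ ℓ₂
  ≤-poset = record { isPartialOrder = ≤.isPartialOrder }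

  open PosetReasoning ≤-poset

  +-monoʳ-≤ : ∀ z {x y} → x ≤ y → z + x ≤ z + y
  +-monoʳ-≤ z {x} {y} x≤y = begin
    z + x ≈⟨ R.+-comm z x ⟩
    x + z ≤⟨ +-mono-≤ z x≤y ⟩
    y + z ≈⟨ R.+-comm y z ⟩
    z + y ∎

  +-nonneg : ∀ {x y} → 0# ≤ x → 0# ≤ y → 0# ≤ x + y
  +-nonneg {x} {y} 0≤x 0≤y = begin
    0#      ≈⟨ R.+-identityʳ 0# ⟨
    0# + 0# ≤⟨ +-mono-≤ 0# 0≤x ⟩
    x + 0#  ≤⟨ +-monoʳ-≤ x 0≤y ⟩
    x + y   ∎

  -‿nonneg : ∀ {x} → x ≤ 0# → 0# ≤ - x
  -‿nonneg {x} x≤0 = begin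
    0#       ≈⟨ R.-‿inverseʳ x ⟨
    x + - x  ≤⟨ +-mono-≤ (- x) x≤0 ⟩
    0# + - x ≈⟨ R.+-identityˡ (- x) ⟩
    - x      ∎

  0≤1 : 0# ≤ 1#
  0≤1 with ≤.total 0# 1#
  ... | inj₁ 0≤1 = 0≤1
  ... | inj₂ 1≤0 = begin
    0#          ≤⟨ *-nonneg (-‿nonneg 1≤0) (-‿nonneg 1≤0) ⟩
    - 1# * - 1# ≈⟨ Rₚ.-1*x≈-x (- 1#) ⟩
    - - 1#      ≈⟨ Rₚ.-‿involutive 1# ⟩
    1#          ∎

  +-nonneg⁻ : ∀ {x y} → 0# ≤ x + y → 0# ≤ x ⊎ 0# ≤ y
  +-nonneg⁻ {x} {y} 0≤x+y with ≤.total 0# x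
  ... | inj₁ 0≤x = inj₁ 0≤x
  ... | inj₂ x≤0 = inj₂ (begin
    0#      ≤⟨ 0≤x+y ⟩
    x + y   ≤⟨ +-mono-≤ y x≤0 ⟩
    0# + y  ≈⟨ R.+-identityˡ y ⟩
    y       ∎)

  1+1≉0 : ¬ (1# + 1# ≈ 0#)
  1+1≉0 1+1≈0 = 0≉1 (≤.antisym 0≤1 (begin
    1#      ≈⟨ R.+-identityʳ 1# ⟨
    1# + 0# ≤⟨ +-monoʳ-≤ 1# 0≤1 ⟩
    1# + 1# ≈⟨ 1+1≈0 ⟩
    0#      ∎))

  half+half≈1 : half + half ≈ 1#
  half+half≈1 = begin-equality
    half + half           ≈⟨ R.+-cong (R.*-identityˡ half) (R.*-identityˡ half) ⟨
    1# * half + 1# * half ≈⟨ R.distribʳ half 1# 1# ⟨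
    (1# + 1#) * half      ≈⟨ ⁻¹-inverse (1# + 1#) 1+1≉0 ⟩
    1#                    ∎

  fromℕ-nonneg : ∀ d → 0# ≤ fromℕ d
  fromℕ-nonneg ℕ.zero    = ≤.refl
  fromℕ-nonneg (ℕ.suc d) = +-nonneg 0≤1 (fromℕ-nonneg d)

  fromℕ-mono : ∀ {d e} → d ℕ.≤ e → fromℕ d ≤ fromℕ e
  fromℕ-mono {e = e} ℕ.z≤n = fromℕ-nonneg e
  fromℕ-mono (ℕ.s≤s d≤e)   = +-monoʳ-≤ 1# (fromℕ-mono d≤e)

  fromℕ-pos : ∀ {d} → 0 ℕ.< d → 0# < fromℕ d
  fromℕ-pos {ℕ.suc d} _ = fromℕ-nonneg (ℕ.suc d) , λ 0≈1+d → 0≉1 (≤.antisym 0≤1 (begin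
    1#               ≈⟨ R.+-identityʳ 1# ⟨
    1# + 0#          ≤⟨ +-monoʳ-≤ 1# (fromℕ-nonneg d) ⟩
    fromℕ (ℕ.suc d)  ≈⟨ 0≈1+d ⟨
    0#               ∎))

  s*x≰x : ∀ {s x} → 1# < s → 0# < x → ¬ (s * x ≤ x)
  s*x≰x {s} {x} (1≤s , 1≉s) (0≤x , 0≉x) s*x≤x = 1≉s (R.sym s≈1)
    where
    t : Carrier
    t = s + - 1#
    t*x≈s*x-x : t * x ≈ s * x + - x
    t*x≈s*x-x = R.trans (R.distribʳ x s (- 1#)) (R.+-congˡ (Rₚ.-1*x≈-x x))
    t*x≈0 : t * x ≈ 0#
    t*x≈0 = ≤.antisym
      (begin
        t * x      ≈⟨ t*x≈s*x-x ⟩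
        s * x + - x ≤⟨ +-mono-≤ (- x) s*x≤x ⟩
        x + - x    ≈⟨ R.-‿inverseʳ x ⟩
        0#         ∎)
      (*-nonneg (begin
        0#         ≈⟨ R.-‿inverseʳ 1# ⟨
        1# + - 1#  ≤⟨ +-mono-≤ (- 1#) 1≤s ⟩
        t          ∎) 0≤x)
    s≈1 : s ≈ 1#
    s≈1 = Rₚ.x∙y⁻¹≈ε⇒x≈y s 1# (begin-equality
      t                ≈⟨ R.*-identityʳ t ⟨
      t * 1#           ≈⟨ R.*-congˡ (⁻¹-inverse x (0≉x ∘ R.sym)) ⟨
      t * (x * x ⁻¹)   ≈⟨ R.*-assoc t x (x ⁻¹) ⟨
      t * x * x ⁻¹     ≈⟨ R.*-congʳ t*x≈0 ⟩
      0# * x ⁻¹        ≈⟨ R.zeroˡ (x ⁻¹) ⟩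
      0#               ∎)

  module KΣ = CommutativeMonoidSum R.+-commutativeMonoid

  sumFin≡sum : ∀ {k} (f : Fin k → Carrier) → sumFin f ≡ KΣ.sum f
  sumFin≡sum {ℕ.zero}  f = refl
  sumFin≡sum {ℕ.suc k} f = cong (f zero +_) (sumFin≡sum (f ∘ suc))

  ∑-nonneg : ∀ {k} (f : Fin k → Carrier) → (∀ i → 0# ≤ f i) → 0# ≤ KΣ.sum f
  ∑-nonneg {ℕ.zero}  f 0≤f = ≤.refl
  ∑-nonneg {ℕ.suc k} f 0≤f = +-nonneg (0≤f zero) (∑-nonneg (f ∘ suc) (0≤f ∘ suc))

module Parity where

  Assignment : ℕ → Set
  Assignment n = Fin n → Bool

  flipAt : ∀ {n} → Fin n → Assignment n → Assignment n
  flipAt y σ = updateAt σ y not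

  parity-cong : ∀ {n} (S : Subset n) {σ τ : Assignment n} →
                (∀ {i} → i ∈ S → σ i ≡ τ i) → parity S σ ≡ parity S τ
  parity-cong []          σ≗τ = refl
  parity-cong (true  ∷ S) σ≗τ = cong₂ _xor_ (cong (true ∧_) (σ≗τ here)) (parity-cong S (σ≗τ ∘ there))
  parity-cong (false ∷ S) σ≗τ = parity-cong S (σ≗τ ∘ there)

  parity-flipAt : ∀ {n} {S : Subset n} (σ : Assignment n) {y} → y ∈ S →
                  parity S (flipAt y σ) ≡ not (parity S σ)
  parity-flipAt {S = true ∷ S} σ here = sym (Boolₚ.not-distribˡ-xor (σ zero) (parity S (σ ∘ suc)))
  parity-flipAt {S = s ∷ S} σ (there y∈S) = begin
    (s ∧ σ zero) xor parity S (flipAt _ (σ ∘ suc)) ≡⟨ cong ((s ∧ σ zero) xor_) (parity-flipAt (σ ∘ suc) y∈S) ⟩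
    (s ∧ σ zero) xor not (parity S (σ ∘ suc))     ≡⟨ Boolₚ.not-distribʳ-xor (s ∧ σ zero) _ ⟨
    not ((s ∧ σ zero) xor parity S (σ ∘ suc))     ∎
    where open ≡-Reasoning

  parity-flipAt-flipAt : ∀ {n} {S : Subset n} (σ : Assignment n) {y z} → y ∈ S → z ∈ S →
                         parity S (flipAt z (flipAt y σ)) ≡ parity S σ
  parity-flipAt-flipAt {S = S} σ {y} {z} y∈S z∈S = begin
    parity S (flipAt z (flipAt y σ)) ≡⟨ parity-flipAt (flipAt y σ) z∈S ⟩
    not (parity S (flipAt y σ))      ≡⟨ cong not (parity-flipAt σ y∈S) ⟩
    not (not (parity S σ))           ≡⟨ Boolₚ.not-involutive _ ⟩
    parity S σ                       ∎
    where open ≡-Reasoning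

  flipAt-flipAt : ∀ {n} {y z : Fin n} → y ≢ z → (σ : Assignment n) →
                  ∀ {i} → i ≡ y ⊎ i ≡ z → flipAt z (flipAt y σ) i ≡ not (σ i)
  flipAt-flipAt {y = y} {z} y≢z σ (inj₁ refl) =
    trans (updateAt-minimal y z (flipAt y σ) y≢z) (updateAt-updates y σ)
  flipAt-flipAt {y = y} {z} y≢z σ (inj₂ refl) =
    trans (updateAt-updates z (flipAt y σ)) (cong not (updateAt-minimal z y σ (y≢z ∘ sym)))

  flipAt-flipAt-minimal : ∀ {n} {y z : Fin n} (σ : Assignment n) →
                          ∀ {i} → i ≢ y → i ≢ z → flipAt z (flipAt y σ) i ≡ σ i
  flipAt-flipAt-minimal {y = y} {z} σ {i} i≢y i≢z =
    trans (updateAt-minimal i z (flipAt y σ) i≢z) (updateAt-minimal i y σ i≢y)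

  flipAtIf : ∀ {n} → Bool → Fin n → Assignment n → Assignment n
  flipAtIf false y σ = σ
  flipAtIf true  y σ = flipAt y σ

  repair : ∀ {n} → Subset n → Bool → Fin n → Assignment n → Assignment n
  repair S b y σ = flipAtIf (parity S σ xor b) y σ

  parity-repair : ∀ {n} (S : Subset n) b (σ : Assignment n) {y} → y ∈ S → parity S (repair S b y σ) ≡ b
  parity-repair S b σ {y} y∈S = go (parity S σ) b refl
    where
    go : ∀ p b → parity S σ ≡ p → parity S (flipAtIf (p xor b) y σ) ≡ b
    go true  true  p≡ = p≡
    go false false p≡ = p≡
    go true  false p≡ = trans (parity-flipAt σ y∈S) (cong not p≡)
    go false true  p≡ = trans (parity-flipAt σ y∈S) (cong not p≡)

  repair-minimal : ∀ {n} (S : Subset n) b y (σ : Assignment n) {i} → i ≢ y → repair S b y σ i ≡ σ i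
  repair-minimal S b y σ i≢y with parity S σ xor b
  ... | false = refl
  ... | true  = updateAt-minimal _ y σ i≢y

open Parity

module Excess {c ℓ₁ ℓ₂} (K : OrderedField c ℓ₁ ℓ₂) where

  open OrderedField K
  open OrderedFieldProperties K
  open PosetReasoning ≤-poset

  -- deviation a b = a (b − ½), and excess a S σ = Σ_{i ∈ S} aᵢ (σᵢ − ½).
  deviation : Carrier → Bool → Carrier
  deviation a true  = a * half
  deviation a false = - (a * half)

  deviation-not : ∀ a b → deviation a b + deviation a (not b) ≈ 0#
  deviation-not a true  = R.-‿inverseʳ (a * half)
  deviation-not a false = R.-‿inverseˡ (a * half)

  best : Carrier → Bool
  best a with ≤.total 0# (a * half)
  ... | inj₁ _ = true
  ... | inj₂ _ = false

  deviation-best : ∀ a → 0# ≤ deviation a (best a)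
  deviation-best a with ≤.total 0# (a * half)
  ... | inj₁ 0≤a/2 = 0≤a/2
  ... | inj₂ a/2≤0 = -‿nonneg a/2≤0

  toVal : Bool → Val
  toVal true  = v1
  toVal false = v0

  *valK≈*half+deviation : ∀ a b → a * valK K (toVal b) ≈ a * half + deviation a b
  *valK≈*half+deviation a true = begin-equality
    a * 1#               ≈⟨ R.*-congˡ half+half≈1 ⟨
    a * (half + half)    ≈⟨ R.distribˡ a half half ⟩
    a * half + a * half  ∎
  *valK≈*half+deviation a false = begin-equality
    a * 0#               ≈⟨ R.zeroʳ a ⟩
    0#                   ≈⟨ R.-‿inverseʳ (a * half) ⟨
    a * half + - (a * half) ∎

  module _ {n} (a : Fin n → Carrier) where

    excess : (Fin n → Bool) → Assignment n → Carrier
    excess S σ = KΣ.sum λ i → if S i then deviation (a i) (σ i) else 0#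

    excess-split : ∀ (S S' V : Fin n → Bool) {σ σ' : Assignment n} →
                   (∀ i → S i ≡ S' i ∨ V i) → (∀ i → S' i ≡ true → σ' i ≡ σ i) →
                   excess S σ' ≈ excess S' σ + excess (λ i → V i ∧ not (S' i)) σ'
    excess-split S S' V {σ} {σ'} S≡S'∨V agree = begin-equality
      excess S σ'                                 ≈⟨ KΣ.sum-cong-≋ pointwise ⟩
      KΣ.sum (λ i → old i + new i)                ≈⟨ KΣ.∑-distrib-+ old new ⟩
      excess S' σ + excess (λ i → V i ∧ not (S' i)) σ' ∎
      where
      old new : Fin n → Carrier
      old i = if S' i then deviation (a i) (σ i) else 0#
      new i = if V i ∧ not (S' i) then deviation (a i) (σ' i) else 0#
      pointwise : ∀ i → (if S i then deviation (a i) (σ' i) else 0#) ≈ old i + new i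
      pointwise i rewrite S≡S'∨V i with S' i in S'i | V i
      ... | true  | v     rewrite agree i S'i | Boolₚ.∧-zeroʳ v = R.sym (R.+-identityʳ _)
      ... | false | true  = R.sym (R.+-identityˡ _)
      ... | false | false = R.sym (R.+-identityˡ _)

    excess-pair-nonneg : ∀ (V : Fin n → Bool) (σ₁ σ₂ : Assignment n) →
      (∀ i → V i ≡ true → σ₂ i ≡ not (σ₁ i) ⊎ (σ₁ i ≡ best (a i) × σ₂ i ≡ best (a i))) →
      0# ≤ excess V σ₁ + excess V σ₂
    excess-pair-nonneg V σ₁ σ₂ paired = begin
      0#                                    ≤⟨ ∑-nonneg (λ i → term σ₁ i + term σ₂ i) pointwise ⟩
      KΣ.sum (λ i → term σ₁ i + term σ₂ i)  ≈⟨ KΣ.∑-distrib-+ (term σ₁) (term σ₂) ⟩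
      excess V σ₁ + excess V σ₂             ∎
      where
      term : Assignment n → Fin n → Carrier
      term σ i = if V i then deviation (a i) (σ i) else 0#
      pointwise : ∀ i → 0# ≤ term σ₁ i + term σ₂ i
      pointwise i with V i in Vi
      ... | false = +-nonneg ≤.refl ≤.refl
      ... | true with paired i Vi
      ...   | inj₁ σ₂≡¬σ₁ rewrite σ₂≡¬σ₁ = ≤.reflexive (R.sym (deviation-not (a i) (σ₁ i)))
      ...   | inj₂ (σ₁≡best , σ₂≡best) rewrite σ₁≡best | σ₂≡best =
                +-nonneg (deviation-best (a i)) (deviation-best (a i))

module Construction {c ℓ₁ ℓ₂} (K : OrderedField c ℓ₁ ℓ₂) {m n : ℕ} (F : System m n)
                    (a : Fin n → OrderedField.Carrier K) where

  open OrderedField K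
  open OrderedFieldProperties K
  open Excess K

  Satisfies : Subset m → Assignment n → Set
  Satisfies W σ = ∀ {j} → j ∈ W → parity (vars (F j)) σ ≡ rhs (F j)

  record GoodSolution (W : Subset m) : Set ℓ₂ where
    field
      assignment    : Assignment n
      satisfies     : Satisfies W assignment
      excess-nonneg : 0# ≤ excess a (lookup (Γ F W)) assignment

  goodSolution-empty : ∀ {W} → Empty W → GoodSolution W
  goodSolution-empty {W} empty = record
    { assignment    = λ _ → false
    ; satisfies     = λ j∈W → ⊥-elim (empty (_ , j∈W))
    ; excess-nonneg = ∑-nonneg _ nothing-in-Γ
    }
    where
    nothing-in-Γ : ∀ i → 0# ≤ (if lookup (Γ F W) i then deviation (a i) false else 0#)
    nothing-in-Γ i with lookup (Γ F W) i in i∈Γ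
    ... | false = ≤.refl
    ... | true  = ⊥-elim (Empty⇒∉Γ F empty (Vecₚ.lookup⇒[]= i _ i∈Γ))

  newVariables : Subset m → Fin m → Fin n → Bool
  newVariables W j i = lookup (vars (F j)) i ∧ not (lookup (Γ F (W - j)) i)

  goodSolution-add : ∀ {W j} → j ∈ W → (sol : GoodSolution (W - j)) → (σ' : Assignment n) →
                     (∀ i → lookup (Γ F (W - j)) i ≡ true → σ' i ≡ GoodSolution.assignment sol i) →
                     parity (vars (F j)) σ' ≡ rhs (F j) → 0# ≤ excess a (newVariables W j) σ' →
                     GoodSolution W
  goodSolution-add {W} {j} j∈W sol σ' agree sat 0≤new = record
    { assignment    = σ'
    ; satisfies     = satisfies'
    ; excess-nonneg = begin
        0#                                               ≤⟨ +-nonneg excess-nonneg 0≤new ⟩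
        excess a old σ + excess a (newVariables W j) σ'  ≈⟨ split ⟨
        excess a (lookup (Γ F W)) σ'                     ∎
    }
    where
    open GoodSolution sol renaming (assignment to σ)
    open PosetReasoning ≤-poset

    old : Fin n → Bool
    old = lookup (Γ F (W - j))

    split : excess a (lookup (Γ F W)) σ' ≈ excess a old σ + excess a (newVariables W j) σ'
    split = excess-split a (lookup (Γ F W)) old (lookup (vars (F j))) (lookup-Γ-remove F j∈W) agree

    satisfies' : Satisfies W σ'
    satisfies' {j'} j'∈W with j' ≟ j
    ... | yes refl = sat
    ... | no j'≢j  = trans (parity-cong (vars (F j')) λ {i} i∈Fj' →
                             agree i (Vecₚ.[]=⇒lookup (∈Γ⁺ F j'∈W-j i∈Fj')))
                           (satisfies j'∈W-j)
      where
      j'∈W-j : j' ∈ W - j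
      j'∈W-j = Subsetₚ.x∈p∧x≢y⇒x∈p-y j'∈W j'≢j

  goodSolution-extend : ∀ {W j y z} → j ∈ W → y ≢ z →
                        UniqueNeighbour F W j y → UniqueNeighbour F W j z →
                        GoodSolution (W - j) → GoodSolution W
  goodSolution-extend {W} {j} {y} {z} j∈W y≢z y-unique z-unique sol =
    [ goodSolution-add j∈W sol σ₁ agree₁ sat₁ , goodSolution-add j∈W sol σ₂ agree₂ sat₂ ]′
      (+-nonneg⁻ (excess-pair-nonneg a new σ₁ σ₂ paired))
    where
    open GoodSolution sol renaming (assignment to σ)
    Fj : Subset n
    Fj = vars (F j)
    old new : Fin n → Bool
    old = lookup (Γ F (W - j))
    new = newVariables W j

    σ₀ σ₁ σ₂ : Assignment n
    σ₀ i = if new i then best (a i) else σ i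
    σ₁ = repair Fj (rhs (F j)) y σ₀
    σ₂ = flipAt z (flipAt y σ₁)

    old⇒≢ : ∀ {i x} → old i ≡ true → UniqueNeighbour F W j x → i ≢ x
    old⇒≢ {i} i∈old x-unique refl =
      uniqueNeighbour⇒∉Γ-remove F x-unique (Vecₚ.lookup⇒[]= i _ i∈old)

    agree₀ : ∀ i → old i ≡ true → σ₀ i ≡ σ i
    agree₀ i i∈old rewrite i∈old | Boolₚ.∧-zeroʳ (lookup Fj i) = refl

    agree₁ : ∀ i → old i ≡ true → σ₁ i ≡ σ i
    agree₁ i i∈old = trans (repair-minimal Fj _ y σ₀ (old⇒≢ i∈old y-unique)) (agree₀ i i∈old)

    agree₂ : ∀ i → old i ≡ true → σ₂ i ≡ σ i
    agree₂ i i∈old = trans (flipAt-flipAt-minimal σ₁ (old⇒≢ i∈old y-unique) (old⇒≢ i∈old z-unique))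
                           (agree₁ i i∈old)

    sat₁ : parity Fj σ₁ ≡ rhs (F j)
    sat₁ = parity-repair Fj (rhs (F j)) σ₀ (proj₁ y-unique)

    sat₂ : parity Fj σ₂ ≡ rhs (F j)
    sat₂ = trans (parity-flipAt-flipAt σ₁ (proj₁ y-unique) (proj₁ z-unique)) sat₁

    paired : ∀ i → new i ≡ true → σ₂ i ≡ not (σ₁ i) ⊎ (σ₁ i ≡ best (a i) × σ₂ i ≡ best (a i))
    paired i i∈new with i ≟ y | i ≟ z
    ... | yes i≡y | _       = inj₁ (flipAt-flipAt y≢z σ₁ (inj₁ i≡y))
    ... | no _    | yes i≡z = inj₁ (flipAt-flipAt y≢z σ₁ (inj₂ i≡z))
    ... | no i≢y  | no i≢z  = inj₂ (σ₁≡best , trans (flipAt-flipAt-minimal σ₁ i≢y i≢z) σ₁≡best)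
      where
      σ₁≡best : σ₁ i ≡ best (a i)
      σ₁≡best rewrite repair-minimal Fj (rhs (F j)) y σ₀ i≢y | i∈new = refl

module Expansion {c ℓ₁ ℓ₂} (K : OrderedField c ℓ₁ ℓ₂) {m n : ℕ} (F : System m n)
                 (r : ℕ) (s : OrderedField.Carrier K) (1<s : OrderedField._<_ K (OrderedField.1# K) s)
                 (expander : IsBoundaryExpander K F r s) where

  open OrderedField K
  open OrderedFieldProperties K
  open Construction K F

  ∣W∣<∣δW∣ : ∀ {W} → Nonempty W → ∣ W ∣ ℕ.≤ r → ∣ W ∣ ℕ.< ∣ δ F W ∣
  ∣W∣<∣δW∣ {W} (j , j∈W) ∣W∣≤r = ℕₚ.≰⇒> λ ∣δW∣≤∣W∣ → s*x≰x 1<s (fromℕ-pos 0<∣W∣) (begin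
    s * fromℕ ∣ W ∣  ≤⟨ expander W ∣W∣≤r ⟩
    fromℕ ∣ δ F W ∣  ≤⟨ fromℕ-mono ∣δW∣≤∣W∣ ⟩
    fromℕ ∣ W ∣      ∎)
    where
    open PosetReasoning ≤-poset
    0<∣W∣ : 0 ℕ.< ∣ W ∣
    0<∣W∣ = ℕₚ.≤-<-trans ℕ.z≤n (Subsetₚ.x∈p⇒∣p-x∣<∣p∣ j∈W)

  goodSolution : ∀ a W → ∣ W ∣ ℕ.≤ r → GoodSolution a W
  goodSolution a W = go W (ℕᵢ.<-wellFounded ∣ W ∣)
    where
    go : ∀ W → Acc ℕ._<_ ∣ W ∣ → ∣ W ∣ ℕ.≤ r → GoodSolution a W
    go W (acc smaller) ∣W∣≤r with Subsetₚ.nonempty? W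
    ... | no empty = goodSolution-empty a empty
    ... | yes nonempty
      with j , j∈W , y , z , y≢z , y-unique , z-unique ← ∣W∣<∣δW∣⇒uniqueNeighbours F W (∣W∣<∣δW∣ nonempty ∣W∣≤r)
      = goodSolution-extend a j∈W y≢z y-unique z-unique
          (go (W - j) (smaller ∣W-j∣<∣W∣) (ℕₚ.≤-trans (ℕₚ.<⇒≤ ∣W-j∣<∣W∣) ∣W∣≤r))
      where
      ∣W-j∣<∣W∣ : ∣ W - j ∣ ℕ.< ∣ W ∣
      ∣W-j∣<∣W∣ = Subsetₚ.x∈p⇒∣p-x∣<∣p∣ j∈W

module Restricting {c ℓ₁ ℓ₂} (K : OrderedField c ℓ₁ ℓ₂) {n : ℕ} where

  open OrderedField K
  open OrderedFieldProperties K
  open Excess K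

  restrictBy : Subset n → Assignment n → Restriction n
  restrictBy S σ i = if lookup S i then toVal (σ i) else ⋆

  fix-restrictBy : ∀ S σ → fix (restrictBy S σ) ≡ S
  fix-restrictBy S σ = trans (Vecₚ.tabulate-cong λ i → fixed (lookup S i) (σ i)) (Vecₚ.tabulate∘lookup S)
    where
    fixed : ∀ g b → isFixed (if g then toVal b else ⋆) ≡ g
    fixed true  true  = refl
    fixed true  false = refl
    fixed false _     = refl

  valBool-restrictBy : ∀ S σ {i} → i ∈ S → valBool (restrictBy S σ i) ≡ σ i
  valBool-restrictBy S σ {i} i∈S rewrite Vecₚ.[]=⇒lookup i∈S with σ i
  ... | true  = refl
  ... | false = refl

  isFixed-restrictBy : ∀ S σ {i} → i ∈ S → isFixed (restrictBy S σ i) ≡ true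
  isFixed-restrictBy S σ {i} i∈S rewrite Vecₚ.[]=⇒lookup i∈S with σ i
  ... | true  = refl
  ... | false = refl

  restrictBy-satisfies : ∀ S σ (C : Equation n) → (∀ {i} → i ∈ vars C → i ∈ S) →
                         parity (vars C) σ ≡ rhs C → SatisfiedBy C (restrictBy S σ)
  restrictBy-satisfies S σ C C⊆S sat =
      (λ i i∈C → isFixed-restrictBy S σ (C⊆S i∈C))
    , trans (parity-cong (vars C) (valBool-restrictBy S σ ∘ C⊆S)) sat

  restrictBy-good : ∀ (H : Halfspace K n) S σ → IsGood H →
                    0# ≤ excess (Halfspace.coeff H) (lookup S) σ → IsGood↾ H (restrictBy S σ)
  restrictBy-good H S σ good 0≤excess = α , α∈H , (λ i → α-fixed (lookup S i) (σ i)) , λ i → α-free (lookup S i) (σ i)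
    where
    open Halfspace H
    open PosetReasoning ≤-poset

    α : Fin n → Carrier
    α i = if lookup S i then valK K (toVal (σ i)) else half

    α-fixed : ∀ g b → isFixed (if g then toVal b else ⋆) ≡ true →
              (if g then valK K (toVal b) else half) ≈ valK K (if g then toVal b else ⋆)
    α-fixed true _ _ = R.refl

    α-free : ∀ g b → (if g then toVal b else ⋆) ≡ ⋆ → (if g then valK K (toVal b) else half) ≈ half
    α-free true  true  ()
    α-free true  false ()
    α-free false _     _ = R.refl

    coeff*α : ∀ g b cᵢ → cᵢ * (if g then valK K (toVal b) else half) ≈ cᵢ * half + (if g then deviation cᵢ b else 0#)
    coeff*α true  b cᵢ = *valK≈*half+deviation cᵢ b
    coeff*α false b cᵢ = R.sym (R.+-identityʳ (cᵢ * half))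

    atHalf gain : Fin n → Carrier
    atHalf i = coeff i * half
    gain   i = if lookup S i then deviation (coeff i) (σ i) else 0#

    α∈H : α ∈H H
    α∈H = begin
      bound                                     ≤⟨ good ⟩
      sumFin atHalf                             ≡⟨ sumFin≡sum atHalf ⟩
      KΣ.sum atHalf                             ≈⟨ R.+-identityʳ _ ⟨
      KΣ.sum atHalf + 0#                        ≤⟨ +-monoʳ-≤ _ 0≤excess ⟩
      KΣ.sum atHalf + KΣ.sum gain               ≈⟨ KΣ.∑-distrib-+ atHalf gain ⟨
      KΣ.sum (λ i → atHalf i + gain i)          ≈⟨ KΣ.sum-cong-≋ (λ i → coeff*α (lookup S i) (σ i) (coeff i)) ⟨
      KΣ.sum (λ i → coeff i * α i)              ≡⟨ sumFin≡sum (λ i → coeff i * α i) ⟨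
      sumFin (λ i → coeff i * α i)              ∎

open import Data.Nat using (_≤_)

lemma5p9 : ∀ {c ℓ₁ ℓ₂} (K : OrderedField c ℓ₁ ℓ₂) {m n : ℕ}
    (F : System m n) (r : ℕ) (s : OrderedField.Carrier K) →
    OrderedField._<_ K (OrderedField.1# K) s →
    IsBoundaryExpander K F r s →
    (F' : Subset m) → ∣ F' ∣ ≤ r →
    (H : Halfspace K n) → IsGood H →
    Σ (Restriction n) λ ρ →
      (fix ρ ≡ Γ F F')
      × (∀ (j : Fin m) → j ∈ F' → SatisfiedBy (F j) ρ)
      × IsGood↾ H ρ
lemma5p9 K F r s 1<s expander F' ∣F'∣≤r H good =
    restrictBy (Γ F F') σ
  , fix-restrictBy (Γ F F') σ
  , (λ j j∈F' → restrictBy-satisfies (Γ F F') σ (F j) (∈Γ⁺ F j∈F') (satisfies j∈F'))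
  , restrictBy-good H (Γ F F') σ good excess-nonneg
  where
  open Restricting K
  open Construction.GoodSolution
         (Expansion.goodSolution K F r s 1<s expander (Halfspace.coeff H) F' ∣F'∣≤r)
         renaming (assignment to σ)
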